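{- Let $k\ge 0$, let $G$ be a $k$-spanner, and let $(H,H')\in\Lambda_\mu(G)$. Then both central vertices of $G$ are saturated in $H$ and both are saturated in $H'$.
   Context: All graphs are finite, simple, undirected and loopless. $\lambda(G)=\max\{|H|+|H'| : H,H' \text{ are disjoint matchings in } G\}$, $\Lambda(G)$ is the set of ordered pairs $(H,H')$ of disjoint matchings of $G$ with $|H|+|H'|=\lambda(G)$, $\mu(G)=\max\{|H| : (H,H')\in\Lambda(G)\}$, and $\Lambda_\mu(G)$ is the set of $(H,H')\in\Lambda(G)$ with $|H|=\mu(G)$. A vertex is saturated in a matching $M$ if some edge of $M$ is incident to it. A leg attached at a vertex $c$ is a path $c\,x\,y$ with $x,y$ new vertices. For an integer $k\ge 0$, a $k$-spanner is the tree obtained from two vertices $c_1,c_2$ (the central vertices) joined by an edge, by attaching $p\ge 2$ legs at $c_1$ and $q\ge 2$ legs at $c_2$, with $p+q=k+4$ (all leg vertices distinct). -}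

module Defs where

open import Data.Nat using (ℕ; _+_; _≤_)
open import Data.Bool using (Bool; true; false)
open import Data.Fin using (Fin)
open import Data.List using (List; _∷_; []; _++_; map; filter; length; allFin)
open import Data.Product using (_×_; Σ; ∃)
open import Data.Sum using (_⊎_)
open import Relation.Binary.PropositionalEquality using (_≡_; _≢_)
open import Relation.Nullary using (¬_)
open import Data.Bool.Properties using (T?)
open import Data.Bool using (T)

-- A finite graph presented by its vertex type, edge type, the two
-- endpoints of each edge, and a list enumerating every edge exactly once.

record Graph : Set₁ where
  field
    V        : Set
    E        : Set
    end₁     : E → V
    end₂     : E → V
    edgeList : List E
open Graph public

EdgeSet : Graph → Set
EdgeSet G = E G → Bool

_incident_ : ∀ {G} → V G → E G → Set
_incident_ {G} v e = (end₁ G e ≡ v) ⊎ (end₂ G e ≡ v)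

IsMatching : (G : Graph) → EdgeSet G → Set
IsMatching G M = ∀ (e e' : E G) → M e ≡ true → M e' ≡ true → e ≢ e' →
  ∀ (v : V G) → ¬ ((_incident_ {G} v e) × (_incident_ {G} v e'))

size : (G : Graph) → EdgeSet G → ℕ
size G M = length (filter (λ e → T? (M e)) (edgeList G))

Disjoint : (G : Graph) → EdgeSet G → EdgeSet G → Set
Disjoint G H H' = ∀ (e : E G) → ¬ ((H e ≡ true) × (H' e ≡ true))

DisjointMatchings : (G : Graph) → EdgeSet G → EdgeSet G → Set
DisjointMatchings G H H' = IsMatching G H × IsMatching G H' × Disjoint G H H'

-- (H , H') ∈ Λ(G): |H| + |H'| = λ(G), the maximum over disjoint matching pairs
InΛ : (G : Graph) → EdgeSet G → EdgeSet G → Set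
InΛ G H H' = DisjointMatchings G H H' ×
  (∀ K K' → DisjointMatchings G K K' → size G K + size G K' ≤ size G H + size G H')

-- (H , H') ∈ Λ_μ(G): (H , H') ∈ Λ(G) and |H| = μ(G)
InΛμ : (G : Graph) → EdgeSet G → EdgeSet G → Set
InΛμ G H H' = InΛ G H H' × (∀ K K' → InΛ G K K' → size G K ≤ size G H)

Saturated : (G : Graph) → V G → EdgeSet G → Set
Saturated G v M = Σ (E G) (λ e → (M e ≡ true) × (_incident_ {G} v e))

-- The spanner with p legs at c₁ and q legs at c₂.
-- Legs at c₁: c₁ — x₁ i — y₁ i ; legs at c₂: c₂ — x₂ j — y₂ j.

data SV (p q : ℕ) : Set where
  c₁ c₂ : SV p q
  x₁ y₁ : Fin p → SV p q
  x₂ y₂ : Fin q → SV p q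

data SE (p q : ℕ) : Set where
  central : SE p q
  leg₁ tip₁ : Fin p → SE p q
  leg₂ tip₂ : Fin q → SE p q

SE-end₁ : ∀ {p q} → SE p q → SV p q
SE-end₁ central  = c₁
SE-end₁ (leg₁ i) = c₁
SE-end₁ (tip₁ i) = x₁ i
SE-end₁ (leg₂ j) = c₂
SE-end₁ (tip₂ j) = x₂ j

SE-end₂ : ∀ {p q} → SE p q → SV p q
SE-end₂ central  = c₂
SE-end₂ (leg₁ i) = x₁ i
SE-end₂ (tip₁ i) = y₁ i
SE-end₂ (leg₂ j) = x₂ j
SE-end₂ (tip₂ j) = y₂ j

spanner : ℕ → ℕ → Graph
spanner p q = record
  { V = SV p q
  ; E = SE p q
  ; end₁ = SE-end₁
  ; end₂ = SE-end₂
  ; edgeList = central ∷ map leg₁ (allFin p) ++ map tip₁ (allFin p)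
                 ++ map leg₂ (allFin q) ++ map tip₂ (allFin q)
  }

module Submission where

-- In the spanner with p legs at c₁ and q legs at c₂, every
-- edge is either the central edge, a leg edge (c x) or a tip edge (x y).
-- For a pair of disjoint matchings (H , H') we count edges by class:
--   * the edges at c₁ (central edge and the p edges c₁ x₁ i) form a star,
--     so each matching contains at most one of them, and likewise at c₂;
--   * each tip edge lies in at most one of two disjoint matchings, so
--     together H and H' contain at most p + q tip edges.
-- Counting the central edge once in each star gives
--   |H| + |H'| ≤ star₁ H + star₂ H + star₁ H' + star₂ H' + (p + q),
-- with each star term at most 1.  On the other hand an explicit pair of
-- disjoint matchings of total size p + q + 4 exists, so for (H , H') ∈ Λ
-- all four star terms equal 1, i.e. both central vertices are saturated in
-- both matchings.

open import Defs
open import Data.Nat using (ℕ; zero; suc; _+_; _≤_; z≤n; s≤s)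
open import Data.Nat.Properties
  using (≤-refl; ≤-reflexive; ≤-trans; +-mono-≤; +-monoʳ-≤; +-comm; +-suc; m≤m+n; n≤1+n; +-cancelʳ-≤; +-identityʳ; module ≤-Reasoning)
open import Data.Nat.Tactic.RingSolver using (solve-∀)
open import Data.Bool using (Bool; true; false)
open import Data.Bool.Properties using (T?)
open import Data.Fin using (Fin; zero; suc; _≟_)
open import Data.Fin.Properties using (suc-injective)
open import Data.List using (List; _∷_; _++_; map; filter; length; allFin; tabulate)
open import Data.List.Properties using (map-tabulate; filter-++; length-++)
open import Data.Product using (_×_; _,_; Σ; proj₁; proj₂)
open import Data.Sum using (inj₁; inj₂)
open import Data.Empty using (⊥; ⊥-elim)
open import Function using (_∘_)
open import Function.Definitions using (Injective)
open import Relation.Nullary using (¬_; yes; no)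
open import Relation.Binary.PropositionalEquality

indicator : Bool → ℕ
indicator true  = 1
indicator false = 0

count : ∀ {n} → (Fin n → Bool) → ℕ
count {zero}  b = 0
count {suc n} b = indicator (b zero) + count (b ∘ suc)

count-none : ∀ {n} (b : Fin n → Bool) → (∀ i → b i ≡ false) → count b ≡ 0
count-none {zero}  b none = refl
count-none {suc n} b none rewrite none zero = count-none (b ∘ suc) (none ∘ suc)

count-all : ∀ {n} (b : Fin n → Bool) → (∀ i → b i ≡ true) → count b ≡ n
count-all {zero}  b all = refl
count-all {suc n} b all rewrite all zero = cong suc (count-all (b ∘ suc) (all ∘ suc))

count-only-zero : ∀ {n} (b : Fin (suc n) → Bool) → b zero ≡ true →
  (∀ i → b (suc i) ≡ false) → count b ≡ 1
count-only-zero b here rest rewrite here = cong suc (count-none (b ∘ suc) rest)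

not-true : ∀ {x : Bool} → ¬ (x ≡ true) → x ≡ false
not-true {true}  x≢true = ⊥-elim (x≢true refl)
not-true {false} x≢true = refl

count-atMostOne : ∀ {n} (b : Fin n → Bool) →
  (∀ i j → b i ≡ true → b j ≡ true → i ≡ j) → count b ≤ 1
count-atMostOne {zero}  b unique = z≤n
count-atMostOne {suc n} b unique with b zero in b₀
... | true  = ≤-reflexive (cong suc (count-none (b ∘ suc)
                (λ i → not-true (λ bᵢ → zero≢suc (unique zero (suc i) b₀ bᵢ)))))
  where
  zero≢suc : ∀ {i : Fin n} → ¬ (zero ≡ suc i)
  zero≢suc ()
... | false = count-atMostOne (b ∘ suc) (λ i j bᵢ bⱼ → suc-injective (unique (suc i) (suc j) bᵢ bⱼ))

count-disjoint : ∀ {n} (b b' : Fin n → Bool) →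
  (∀ i → b i ≡ true → b' i ≡ true → ⊥) → count b + count b' ≤ n
count-disjoint {zero}  b b' disj = z≤n
count-disjoint {suc n} b b' disj with b zero in b₀ | b' zero in b'₀
... | true  | true  = ⊥-elim (disj zero b₀ b'₀)
... | true  | false = s≤s (count-disjoint (b ∘ suc) (b' ∘ suc) (disj ∘ suc))
... | false | true  = ≤-trans (≤-reflexive (+-suc (count (b ∘ suc)) _))
                        (s≤s (count-disjoint (b ∘ suc) (b' ∘ suc) (disj ∘ suc)))
... | false | false = ≤-trans (count-disjoint (b ∘ suc) (b' ∘ suc) (disj ∘ suc)) (n≤1+n n)

count-witness : ∀ {n} (b : Fin n → Bool) → 1 ≤ count b → Σ (Fin n) (λ i → b i ≡ true)
count-witness {suc n} b pos with b zero in b₀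
... | true  = zero , b₀
... | false with count-witness (b ∘ suc) pos
...   | i , bᵢ = suc i , bᵢ

module _ (G : Graph) where

  matching-star : ∀ {n} (M : EdgeSet G) → IsMatching G M →
    (v : V G) (f : Fin n → E G) → Injective _≡_ _≡_ f →
    (∀ i → _incident_ {G} v (f i)) → count (M ∘ f) ≤ 1
  matching-star M matching v f f-inj at-v = count-atMostOne (M ∘ f) unique
    where
    unique : ∀ i j → M (f i) ≡ true → M (f j) ≡ true → i ≡ j
    unique i j Mfᵢ Mfⱼ with i ≟ j
    ... | yes i≡j = i≡j
    ... | no  i≢j = ⊥-elim (matching (f i) (f j) Mfᵢ Mfⱼ (i≢j ∘ f-inj) v (at-v i , at-v j))

  star-saturated : ∀ {n} (M : EdgeSet G) (v : V G) (f : Fin n → E G) →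
    (∀ i → _incident_ {G} v (f i)) → 1 ≤ count (M ∘ f) → Saturated G v M
  star-saturated M v f at-v pos with count-witness (M ∘ f) pos
  ... | i , Mfᵢ = f i , Mfᵢ , at-v i

  disjoint-family : ∀ {n} (M M' : EdgeSet G) → Disjoint G M M' →
    (f : Fin n → E G) → count (M ∘ f) + count (M' ∘ f) ≤ n
  disjoint-family M M' disj f = count-disjoint (M ∘ f) (M' ∘ f) (λ i Mfᵢ M'fᵢ → disj (f i) (Mfᵢ , M'fᵢ))

  -- A matching is certified by a choice of one edge per vertex: if every
  -- selected edge at v is the chosen one, no two selected edges meet.
  matching-by-choice : (M : EdgeSet G) (choice : V G → E G) →
    (∀ e v → M e ≡ true → _incident_ {G} v e → choice v ≡ e) → IsMatching G M
  matching-by-choice M choice chosen e e' Me Me' e≢e' v (v∈e , v∈e') =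
    e≢e' (trans (sym (chosen e v Me v∈e)) (chosen e' v Me' v∈e'))

selected : ∀ {A : Set} → (A → Bool) → List A → ℕ
selected M xs = length (filter (T? ∘ M) xs)

selected-++ : ∀ {A : Set} (M : A → Bool) xs ys →
  selected M (xs ++ ys) ≡ selected M xs + selected M ys
selected-++ M xs ys = trans (cong length (filter-++ (T? ∘ M) xs ys)) (length-++ (filter (T? ∘ M) xs))

selected-∷ : ∀ {A : Set} (M : A → Bool) x xs →
  selected M (x ∷ xs) ≡ indicator (M x) + selected M xs
selected-∷ M x xs with M x
... | true  = refl
... | false = refl

selected-tabulate : ∀ {A : Set} {n} (M : A → Bool) (f : Fin n → A) →
  selected M (tabulate f) ≡ count (M ∘ f)
selected-tabulate {n = zero}  M f = refl
selected-tabulate {n = suc n} M f =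
  trans (selected-∷ M (f zero) (tabulate (f ∘ suc)))
        (cong (indicator (M (f zero)) +_) (selected-tabulate M (f ∘ suc)))

selected-family : ∀ {A : Set} {n} (M : A → Bool) (f : Fin n → A) →
  selected M (map f (allFin n)) ≡ count (M ∘ f)
selected-family M f = trans (cong (selected M) (map-tabulate (λ i → i) f)) (selected-tabulate M f)

module _ {p q : ℕ} where

  star₁ : Fin (suc p) → SE p q
  star₁ zero    = central
  star₁ (suc i) = leg₁ i

  star₂ : Fin (suc q) → SE p q
  star₂ zero    = central
  star₂ (suc j) = leg₂ j

  star₁-injective : Injective _≡_ _≡_ star₁
  star₁-injective {zero}  {zero}  refl = refl
  star₁-injective {suc i} {suc j} refl = refl

  star₂-injective : Injective _≡_ _≡_ star₂
  star₂-injective {zero}  {zero}  refl = refl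
  star₂-injective {suc i} {suc j} refl = refl

  star₁-at-c₁ : ∀ i → _incident_ {spanner p q} c₁ (star₁ i)
  star₁-at-c₁ zero    = inj₁ refl
  star₁-at-c₁ (suc i) = inj₁ refl

  star₂-at-c₂ : ∀ j → _incident_ {spanner p q} c₂ (star₂ j)
  star₂-at-c₂ zero    = inj₂ refl
  star₂-at-c₂ (suc j) = inj₁ refl

  size-by-list : (M : EdgeSet (spanner p q)) → size (spanner p q) M ≡
    indicator (M central) + (count (M ∘ leg₁) + (count (M ∘ tip₁) + (count (M ∘ leg₂) + count (M ∘ tip₂))))
  size-by-list M =
    begin
      selected M (central ∷ legs₁ ++ tips₁ ++ legs₂ ++ tips₂)
    ≡⟨ selected-∷ M central (legs₁ ++ tips₁ ++ legs₂ ++ tips₂) ⟩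
      indicator (M central) + selected M (legs₁ ++ tips₁ ++ legs₂ ++ tips₂)
    ≡⟨ cong (indicator (M central) +_) (selected-++ M legs₁ (tips₁ ++ legs₂ ++ tips₂)) ⟩
      indicator (M central) + (selected M legs₁ + selected M (tips₁ ++ legs₂ ++ tips₂))
    ≡⟨ cong (λ r → indicator (M central) + (selected M legs₁ + r)) (selected-++ M tips₁ (legs₂ ++ tips₂)) ⟩
      indicator (M central) + (selected M legs₁ + (selected M tips₁ + selected M (legs₂ ++ tips₂)))
    ≡⟨ cong (λ r → indicator (M central) + (selected M legs₁ + (selected M tips₁ + r))) (selected-++ M legs₂ tips₂) ⟩
      indicator (M central) + (selected M legs₁ + (selected M tips₁ + (selected M legs₂ + selected M tips₂)))
    ≡⟨ cong (indicator (M central) +_)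
         (cong₂ _+_ (selected-family M leg₁)
           (cong₂ _+_ (selected-family M tip₁)
             (cong₂ _+_ (selected-family M leg₂) (selected-family M tip₂)))) ⟩
      indicator (M central) + (count (M ∘ leg₁) + (count (M ∘ tip₁) + (count (M ∘ leg₂) + count (M ∘ tip₂))))
    ∎
    where
    open ≡-Reasoning
    legs₁ = map leg₁ (allFin p)
    tips₁ = map tip₁ (allFin p)
    legs₂ = map leg₂ (allFin q)
    tips₂ = map tip₂ (allFin q)

  -- Counting the central edge twice, the size splits into the two stars
  -- and the two tip classes.
  size-by-class : (M : EdgeSet (spanner p q)) →
    size (spanner p q) M + indicator (M central) ≡
    (count (M ∘ star₁) + count (M ∘ star₂)) + (count (M ∘ tip₁) + count (M ∘ tip₂))
  size-by-class M = trans (cong (_+ indicator (M central)) (size-by-list M))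
    (regroup (indicator (M central)) (count (M ∘ leg₁)) (count (M ∘ tip₁)) (count (M ∘ leg₂)) (count (M ∘ tip₂)))
    where
    regroup : ∀ c l₁ t₁ l₂ t₂ → (c + (l₁ + (t₁ + (l₂ + t₂)))) + c ≡ ((c + l₁) + (c + l₂)) + (t₁ + t₂)
    regroup = solve-∀

  upper-bound : (H H' : EdgeSet (spanner p q)) → DisjointMatchings (spanner p q) H H' →
    size (spanner p q) H + size (spanner p q) H' ≤
    ((count (H ∘ star₁) + count (H ∘ star₂)) + (count (H' ∘ star₁) + count (H' ∘ star₂))) + (p + q)
  upper-bound H H' (_ , _ , disjoint) =
    begin
      size G H + size G H'
    ≤⟨ +-mono-≤ (m≤m+n (size G H) (indicator (H central))) (m≤m+n (size G H') (indicator (H' central))) ⟩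
      (size G H + indicator (H central)) + (size G H' + indicator (H' central))
    ≡⟨ cong₂ _+_ (size-by-class H) (size-by-class H') ⟩
      (S + (t₁ + t₂)) + (S' + (t₁' + t₂'))
    ≡⟨ regroup S S' t₁ t₂ t₁' t₂' ⟩
      (S + S') + ((t₁ + t₁') + (t₂ + t₂'))
    ≤⟨ +-monoʳ-≤ (S + S') (+-mono-≤ (disjoint-family G H H' disjoint tip₁) (disjoint-family G H H' disjoint tip₂)) ⟩
      (S + S') + (p + q)
    ∎
    where
    open ≤-Reasoning
    G = spanner p q
    S = count (H ∘ star₁) + count (H ∘ star₂)
    S' = count (H' ∘ star₁) + count (H' ∘ star₂)
    t₁ = count (H ∘ tip₁)
    t₂ = count (H ∘ tip₂)
    t₁' = count (H' ∘ tip₁)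
    t₂' = count (H' ∘ tip₂)
    regroup : ∀ S S' t₁ t₂ t₁' t₂' → (S + (t₁ + t₂)) + (S' + (t₁' + t₂')) ≡ (S + S') + ((t₁ + t₁') + (t₂ + t₂'))
    regroup = solve-∀

-- A pair of disjoint matchings of total size p + q + 4 (for p, q ≥ 2).
-- K takes the first leg edge at each centre and the tip edges of all
-- other legs; K' takes the second leg edge at each centre and the tip
-- edges of the first legs.

module Extremal {p' q' : ℕ} where
  P Q : ℕ
  P = suc (suc p')
  Q = suc (suc q')

  K : SE P Q → Bool
  K central        = false
  K (leg₁ zero)    = true
  K (leg₁ (suc _)) = false
  K (tip₁ zero)    = false
  K (tip₁ (suc _)) = true
  K (leg₂ zero)    = true
  K (leg₂ (suc _)) = false
  K (tip₂ zero)    = false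
  K (tip₂ (suc _)) = true

  K' : SE P Q → Bool
  K' central              = false
  K' (leg₁ zero)          = false
  K' (leg₁ (suc zero))    = true
  K' (leg₁ (suc (suc _))) = false
  K' (tip₁ zero)          = true
  K' (tip₁ (suc _))       = false
  K' (leg₂ zero)          = false
  K' (leg₂ (suc zero))    = true
  K' (leg₂ (suc (suc _))) = false
  K' (tip₂ zero)          = true
  K' (tip₂ (suc _))       = false

  choice : SV P Q → SE P Q
  choice c₁            = leg₁ zero
  choice c₂            = leg₂ zero
  choice (x₁ zero)     = leg₁ zero
  choice (x₁ (suc i))  = tip₁ (suc i)
  choice (y₁ i)        = tip₁ i
  choice (x₂ zero)     = leg₂ zero
  choice (x₂ (suc j))  = tip₂ (suc j)
  choice (y₂ j)        = tip₂ j

  choice' : SV P Q → SE P Q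
  choice' c₁                = leg₁ (suc zero)
  choice' c₂                = leg₂ (suc zero)
  choice' (x₁ (suc zero))   = leg₁ (suc zero)
  choice' (x₁ i)            = tip₁ i
  choice' (y₁ i)            = tip₁ i
  choice' (x₂ (suc zero))   = leg₂ (suc zero)
  choice' (x₂ j)            = tip₂ j
  choice' (y₂ j)            = tip₂ j

  K-chosen : ∀ e v → K e ≡ true → _incident_ {spanner P Q} v e → choice v ≡ e
  K-chosen (leg₁ zero)    _ _ (inj₁ refl) = refl
  K-chosen (leg₁ zero)    _ _ (inj₂ refl) = refl
  K-chosen (tip₁ (suc i)) _ _ (inj₁ refl) = refl
  K-chosen (tip₁ (suc i)) _ _ (inj₂ refl) = refl
  K-chosen (leg₂ zero)    _ _ (inj₁ refl) = refl
  K-chosen (leg₂ zero)    _ _ (inj₂ refl) = refl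
  K-chosen (tip₂ (suc j)) _ _ (inj₁ refl) = refl
  K-chosen (tip₂ (suc j)) _ _ (inj₂ refl) = refl

  K'-chosen : ∀ e v → K' e ≡ true → _incident_ {spanner P Q} v e → choice' v ≡ e
  K'-chosen (leg₁ (suc zero)) _ _ (inj₁ refl) = refl
  K'-chosen (leg₁ (suc zero)) _ _ (inj₂ refl) = refl
  K'-chosen (tip₁ zero)       _ _ (inj₁ refl) = refl
  K'-chosen (tip₁ zero)       _ _ (inj₂ refl) = refl
  K'-chosen (leg₂ (suc zero)) _ _ (inj₁ refl) = refl
  K'-chosen (leg₂ (suc zero)) _ _ (inj₂ refl) = refl
  K'-chosen (tip₂ zero)       _ _ (inj₁ refl) = refl
  K'-chosen (tip₂ zero)       _ _ (inj₂ refl) = refl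

  K-K'-disjoint : Disjoint (spanner P Q) K K'
  K-K'-disjoint (leg₁ zero)    (_ , ())
  K-K'-disjoint (tip₁ (suc i)) (_ , ())
  K-K'-disjoint (leg₂ zero)    (_ , ())
  K-K'-disjoint (tip₂ (suc j)) (_ , ())

  extremal-pair : DisjointMatchings (spanner P Q) K K'
  extremal-pair = matching-by-choice (spanner P Q) K choice K-chosen
                , matching-by-choice (spanner P Q) K' choice' K'-chosen
                , K-K'-disjoint

  size-K : size (spanner P Q) K ≡ (1 + 1) + (suc p' + suc q')
  size-K = trans (sym (+-identityʳ _))
    (trans (size-by-class K)
      (cong₂ _+_ (cong₂ _+_ (count-only-zero (K ∘ leg₁) refl (λ _ → refl))
                            (count-only-zero (K ∘ leg₂) refl (λ _ → refl)))
                 (cong₂ _+_ (count-all (K ∘ tip₁ ∘ suc) (λ _ → refl))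
                            (count-all (K ∘ tip₂ ∘ suc) (λ _ → refl)))))

  size-K' : size (spanner P Q) K' ≡ (1 + 1) + (1 + 1)
  size-K' = trans (sym (+-identityʳ _))
    (trans (size-by-class K')
      (cong₂ _+_ (cong₂ _+_ (count-only-zero (K' ∘ leg₁ ∘ suc) refl (λ _ → refl))
                            (count-only-zero (K' ∘ leg₂ ∘ suc) refl (λ _ → refl)))
                 (cong₂ _+_ (count-only-zero (K' ∘ tip₁) refl (λ _ → refl))
                            (count-only-zero (K' ∘ tip₂) refl (λ _ → refl)))))

  extremal-size : size (spanner P Q) K + size (spanner P Q) K' ≡ 4 + (P + Q)
  extremal-size = trans (cong₂ _+_ size-K size-K') (total p' q')
    where
    total : ∀ a b → ((1 + 1) + (suc a + suc b)) + ((1 + 1) + (1 + 1)) ≡ 4 + (suc (suc a) + suc (suc b))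
    total = solve-∀

both-attained : ∀ {a b k m} → a ≤ k → b ≤ m → k + m ≤ a + b → k ≤ a × m ≤ b
both-attained {a} {b} {k} {m} a≤k b≤m k+m≤a+b =
    +-cancelʳ-≤ m k a (≤-trans k+m≤a+b (+-monoʳ-≤ a b≤m))
  , +-cancelʳ-≤ k m b (≤-trans (≤-reflexive (+-comm m k))
                        (≤-trans k+m≤a+b (≤-trans (+-mono-≤ a≤k ≤-refl) (≤-reflexive (+-comm k b)))))

stars-full : ∀ {p' q'} (H H' : EdgeSet (spanner (suc (suc p')) (suc (suc q')))) →
  InΛ (spanner (suc (suc p')) (suc (suc q'))) H H' →
  (1 ≤ count (H ∘ star₁) × 1 ≤ count (H ∘ star₂)) × (1 ≤ count (H' ∘ star₁) × 1 ≤ count (H' ∘ star₂))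
stars-full {p'} {q'} H H' (pair@(H-matching , H'-matching , _) , maximal) =
  both-attained star₁-H star₂-H two-in-H , both-attained star₁-H' star₂-H' two-in-H'
  where
  open Extremal {p'} {q'}
  G = spanner P Q
  star₁-H = matching-star G H H-matching c₁ star₁ star₁-injective star₁-at-c₁
  star₂-H = matching-star G H H-matching c₂ star₂ star₂-injective star₂-at-c₂
  star₁-H' = matching-star G H' H'-matching c₁ star₁ star₁-injective star₁-at-c₁
  star₂-H' = matching-star G H' H'-matching c₂ star₂ star₂-injective star₂-at-c₂
  -- λ ≥ p + q + 4 (the extremal pair) and λ ≤ stars + (p + q) (upper bound).
  four-stars : 2 + 2 ≤ (count (H ∘ star₁) + count (H ∘ star₂)) + (count (H' ∘ star₁) + count (H' ∘ star₂))
  four-stars = +-cancelʳ-≤ (P + Q) _ _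
    (≤-trans (≤-reflexive (sym extremal-size))
      (≤-trans (maximal K K' extremal-pair) (upper-bound H H' pair)))
  two-in-H : 2 ≤ count (H ∘ star₁) + count (H ∘ star₂)
  two-in-H = proj₁ (both-attained (+-mono-≤ star₁-H star₂-H) (+-mono-≤ star₁-H' star₂-H') four-stars)
  two-in-H' : 2 ≤ count (H' ∘ star₁) + count (H' ∘ star₂)
  two-in-H' = proj₂ (both-attained (+-mono-≤ star₁-H star₂-H) (+-mono-≤ star₁-H' star₂-H') four-stars)

-- Corollary 3.5: both central vertices are saturated in both matchings of
-- any (H , H') ∈ Λ_μ(G); in fact (H , H') ∈ Λ(G) suffices.
corollary3p5 : (k p q : ℕ) → 2 ≤ p → 2 ≤ q → p + q ≡ k + 4 →
    (H H' : EdgeSet (spanner p q)) → InΛμ (spanner p q) H H' →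
    (Saturated (spanner p q) c₁ H × Saturated (spanner p q) c₂ H) ×
    (Saturated (spanner p q) c₁ H' × Saturated (spanner p q) c₂ H')
corollary3p5 k (suc (suc p')) (suc (suc q')) (s≤s (s≤s z≤n)) (s≤s (s≤s z≤n)) _ H H' (inΛ , _)
  with stars-full H H' inΛ
... | (c₁-in-H , c₂-in-H) , (c₁-in-H' , c₂-in-H') =
    (star-saturated G H c₁ star₁ star₁-at-c₁ c₁-in-H , star-saturated G H c₂ star₂ star₂-at-c₂ c₂-in-H)
  , (star-saturated G H' c₁ star₁ star₁-at-c₁ c₁-in-H' , star-saturated G H' c₂ star₂ star₂-at-c₂ c₂-in-H')
  where
  G = spanner (suc (suc p')) (suc (suc q'))
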